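{- Let $\Gamma\subset\Sigma_8$ be the finite set \[ \Gamma=\{(-3)_0,(-3)_2,(-2)_0,(-2)_1,(-2)_2,(-2)_3,(-2)_5,(-2)_7,(-1)_1,(-1)_3,(-1)_4,(-1)_5,(-1)_6,(-1)_7,0_4,0_6\}. \] If $w$ is a subscript-increasing word over $\Sigma_8\setminus\Gamma$, then $\varphi(w)$ contains no factor that is a $5/4$-power of length less than or equal to $25$.
   Context: Let $\Sigma_8=\{n_j : n\in\mathbb{Z},\ 0\le j\le 7\}$ be the infinite alphabet of distinct formal symbols $n_j$. Let $\varphi$ be the $6$-uniform morphism on $\Sigma_8$ (extended to finite and infinite words by concatenation) defined for all $n\in\mathbb{Z}$ by $\varphi(n_0)=0_0 1_1 0_2 0_3 1_4 (n+3)_5$, $\varphi(n_1)=1_6 1_7 0_0 0_1 0_2 (n+2)_3$, $\varphi(n_2)=1_4 1_5 1_6 0_7 0_0 (n+3)_1$, $\varphi(n_3)=0_2 1_3 1_4 0_5 1_6 (n+2)_7$, $\varphi(n_4)=0_0 1_1 0_2 0_3 1_4 (n+1)_5$, $\varphi(n_5)=1_6 1_7 0_0 0_1 0_2 (n+2)_3$, $\varphi(n_6)=1_4 1_5 1_6 0_7 0_0 (n+1)_1$, $\varphi(n_7)=0_2 1_3 1_4 0_5 1_6 (n+2)_7$. A word over $\Sigma_8$ is subscript-increasing if the subscripts of consecutive letters increase by $1$ modulo $8$. A $5/4$-power is a word $xyx$ with $|x|\ge1$ and $|y|=3|x|$. -}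

module Defs where

open import Data.Nat using (ℕ; zero; suc; _+_; _*_; _≤_; _/_; _%_)
open import Data.Integer as ℤ using (ℤ; +_; -[1+_])
open import Data.Fin using (Fin; zero; suc; toℕ)
open import Data.Fin.Base using (_ℕ-_) renaming (suc to fsuc)
open import Data.Product using (_×_; _,_; Σ; ∃; ∃-syntax; proj₁; proj₂)
open import Data.List using (List; []; _∷_; _++_; length; concatMap)
open import Data.Nat.DivMod using ()
open import Relation.Binary.PropositionalEquality using (_≡_)
open import Relation.Nullary using (¬_)

-- The letter n_j is represented as the pair (n , j).
Letter : Set
Letter = ℤ × Fin 8

suc8 : Fin 8 → Fin 8
suc8 zero = suc zero
suc8 (suc zero) = suc (suc zero)
suc8 (suc (suc zero)) = suc (suc (suc zero))
suc8 (suc (suc (suc zero))) = suc (suc (suc (suc zero)))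
suc8 (suc (suc (suc (suc zero)))) = suc (suc (suc (suc (suc zero))))
suc8 (suc (suc (suc (suc (suc zero))))) = suc (suc (suc (suc (suc (suc zero)))))
suc8 (suc (suc (suc (suc (suc (suc zero)))))) = suc (suc (suc (suc (suc (suc (suc zero))))))
suc8 (suc (suc (suc (suc (suc (suc (suc zero))))))) = zero

s0 s1 s2 s3 s4 s5 s6 s7 : Fin 8
s0 = zero
s1 = suc8 s0
s2 = suc8 s1
s3 = suc8 s2
s4 = suc8 s3
s5 = suc8 s4
s6 = suc8 s5
s7 = suc8 s6

z0 z1 z2 z3 m1 m2 m3 : ℤ
z0 = + 0
z1 = + 1
z2 = + 2
z3 = + 3
m1 = -[1+ 0 ]
m2 = -[1+ 1 ]
m3 = -[1+ 2 ]

φ : Letter → List Letter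
φ (n , zero) =
  (z0 , s0) ∷ (z1 , s1) ∷ (z0 , s2) ∷ (z0 , s3) ∷ (z1 , s4) ∷ (n ℤ.+ z3 , s5) ∷ []
φ (n , suc zero) =
  (z1 , s6) ∷ (z1 , s7) ∷ (z0 , s0) ∷ (z0 , s1) ∷ (z0 , s2) ∷ (n ℤ.+ z2 , s3) ∷ []
φ (n , suc (suc zero)) =
  (z1 , s4) ∷ (z1 , s5) ∷ (z1 , s6) ∷ (z0 , s7) ∷ (z0 , s0) ∷ (n ℤ.+ z3 , s1) ∷ []
φ (n , suc (suc (suc zero))) =
  (z0 , s2) ∷ (z1 , s3) ∷ (z1 , s4) ∷ (z0 , s5) ∷ (z1 , s6) ∷ (n ℤ.+ z2 , s7) ∷ []
φ (n , suc (suc (suc (suc zero)))) =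
  (z0 , s0) ∷ (z1 , s1) ∷ (z0 , s2) ∷ (z0 , s3) ∷ (z1 , s4) ∷ (n ℤ.+ z1 , s5) ∷ []
φ (n , suc (suc (suc (suc (suc zero))))) =
  (z1 , s6) ∷ (z1 , s7) ∷ (z0 , s0) ∷ (z0 , s1) ∷ (z0 , s2) ∷ (n ℤ.+ z2 , s3) ∷ []
φ (n , suc (suc (suc (suc (suc (suc zero)))))) =
  (z1 , s4) ∷ (z1 , s5) ∷ (z1 , s6) ∷ (z0 , s7) ∷ (z0 , s0) ∷ (n ℤ.+ z1 , s1) ∷ []
φ (n , suc (suc (suc (suc (suc (suc (suc zero))))))) =
  (z0 , s2) ∷ (z1 , s3) ∷ (z1 , s4) ∷ (z0 , s5) ∷ (z1 , s6) ∷ (n ℤ.+ z2 , s7) ∷ []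

φ* : List Letter → List Letter
φ* = concatMap φ

Γ : List Letter
Γ = (m3 , s0) ∷ (m3 , s2) ∷ (m2 , s0) ∷ (m2 , s1) ∷ (m2 , s2) ∷ (m2 , s3)
  ∷ (m2 , s5) ∷ (m2 , s7) ∷ (m1 , s1) ∷ (m1 , s3) ∷ (m1 , s4) ∷ (m1 , s5)
  ∷ (m1 , s6) ∷ (m1 , s7) ∷ (z0 , s4) ∷ (z0 , s6) ∷ []

open import Data.List.Membership.Propositional using (_∈_) public

data AvoidsΓ : List Letter → Set where
  []  : AvoidsΓ []
  _∷_ : ∀ {a w} → ¬ (a ∈ Γ) → AvoidsΓ w → AvoidsΓ (a ∷ w)

data SubscriptIncreasing : List Letter → Set where
  []   : SubscriptIncreasing []
  [_]  : ∀ a → SubscriptIncreasing (a ∷ [])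
  step : ∀ {a b w} → proj₂ b ≡ suc8 (proj₂ a) →
         SubscriptIncreasing (b ∷ w) → SubscriptIncreasing (a ∷ b ∷ w)

Factor : List Letter → List Letter → Set
Factor u v = Σ (List Letter) λ p → Σ (List Letter) λ s → v ≡ p ++ u ++ s

FiveFourthsPower : List Letter → Set
FiveFourthsPower u = Σ (List Letter) λ x → Σ (List Letter) λ y →
  (1 ≤ length x) × (length y ≡ 3 * length x) × (u ≡ x ++ y ++ x)

-- Only three features of a letter n_j matter: its subscript j and whether n is 0, 1 or
-- something else.  Under this coding all letters of φ(n_j) but the last are fixed, and the
-- last one is n + c for a constant c; avoiding Γ is exactly what makes n + c differ from
-- 0 and 1.  So the coded image of a subscript-increasing word over Σ₈ ∖ Γ reads off a
-- fixed word of period 24 (φ(n_j) and φ(n_{j+4}) have the same coding), and a 5/4-power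
-- xyx in φ(w) codes to a 5/4-power with the same |x| ≤ 5 in that periodic word.  A finite
-- computation over the 24 phases and the five lengths shows there is none.

module Submission where

open import Defs
open import Data.Nat using (ℕ; _≤_)
open import Data.List using (List; length)
open import Data.Product using (_×_)
open import Relation.Nullary using (¬_)

open import Data.Fin using (Fin; zero; suc; toℕ)
import Data.Fin.Properties as Fin
open import Data.Integer using (ℤ; -[1+_])
import Data.Integer as ℤ
open import Data.Integer.Properties using (+-0-abelianGroup)
open import Data.List using ([]; _∷_; _++_; map; applyUpTo; lookup)
open import Data.List.Membership.Propositional using (_∉_)
open import Data.List.Properties using (∷-injectiveˡ; ∷-injectiveʳ; length-++)
import Data.List.Properties as List
open import Data.Nat using (_+_; _*_; _<_; _%_)
import Data.Nat as ℕ
open import Data.Nat.DivMod using (_mod_; %-distribˡ-+; m%n%n≡m%n; m%n<n)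
open import Data.Nat.Properties using (allUpTo?; +-assoc; *-cancelˡ-≤)
open import Data.Nat.Tactic.RingSolver using (solve-∀)
open import Data.Product using (_,_; proj₂)
open import Data.Product.Properties using (≡-dec)
open import Function using (_∘_)
open import Relation.Binary.Definitions using (DecidableEquality)
open import Relation.Binary.PropositionalEquality
open import Relation.Nullary using (¬?; contradiction)
open import Relation.Nullary.Decidable using (True; toWitness; from-yes)

open import Algebra.Properties.AbelianGroup +-0-abelianGroup using (x≈z//y)
open import Data.List.Membership.DecPropositional (≡-dec ℤ._≟_ (Fin._≟_ {8})) using (_∈?_)

applyUpTo-cong : ∀ {A : Set} {f f′ : ℕ → A} → f ≗ f′ → ∀ n → applyUpTo f n ≡ applyUpTo f′ n
applyUpTo-cong f≗f′ ℕ.zero    = refl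
applyUpTo-cong f≗f′ (ℕ.suc n) = cong₂ _∷_ (f≗f′ 0) (applyUpTo-cong (f≗f′ ∘ ℕ.suc) n)

FiveFourthsPowerAt : ∀ {B : Set} → (ℕ → B) → ℕ → Set
FiveFourthsPowerAt f m = applyUpTo f m ≡ applyUpTo (f ∘ (m +_) ∘ (3 * m +_)) m

five-fourths-power-cong : ∀ {B : Set} {f f′ : ℕ → B} {m} → f ≗ f′ →
  FiveFourthsPowerAt f m → FiveFourthsPowerAt f′ m
five-fourths-power-cong {m = m} f≗f′ power =
  trans (sym (applyUpTo-cong f≗f′ m)) (trans power (applyUpTo-cong (f≗f′ ∘ (m +_) ∘ (3 * m +_)) m))

length-xyx : ∀ {A : Set} (x y : List A) → length y ≡ 3 * length x →
  length (x ++ y ++ x) ≡ 5 * length x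
length-xyx x y |y|≡3|x| = begin
  length (x ++ y ++ x)                  ≡⟨ length-++ x ⟩
  length x + length (y ++ x)            ≡⟨ cong (length x +_) (length-++ y) ⟩
  length x + (length y + length x)      ≡⟨ cong (λ k → length x + (k + length x)) |y|≡3|x| ⟩
  length x + (3 * length x + length x)  ≡⟨ five (length x) ⟩
  5 * length x                          ∎
  where
  open ≡-Reasoning
  five : ∀ m → m + (3 * m + m) ≡ 5 * m
  five = solve-∀

module Coding {A B : Set} (g : A → B) where

  Reads : (ℕ → B) → List A → Set
  Reads f v = map g v ≡ applyUpTo f (length v)

  reads-cong : ∀ {f f′ v} → f ≗ f′ → Reads f v → Reads f′ v
  reads-cong {v = v} f≗f′ rv = trans rv (applyUpTo-cong f≗f′ (length v))

  reads-++ : ∀ {f k} u {v} → map g u ≡ applyUpTo f k → Reads (f ∘ (k +_)) v → Reads f (u ++ v)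
  reads-++ {k = ℕ.zero}  []      _  rv = rv
  reads-++ {k = ℕ.suc _} []      () _
  reads-++ {k = ℕ.zero}  (_ ∷ _) () _
  reads-++ {k = ℕ.suc _} (_ ∷ u) eq rv =
    cong₂ _∷_ (∷-injectiveˡ eq) (reads-++ u (∷-injectiveʳ eq) rv)

  reads-prefix : ∀ {f} u {s} → Reads f (u ++ s) → Reads f u
  reads-prefix []      _  = refl
  reads-prefix (_ ∷ u) eq = cong₂ _∷_ (∷-injectiveˡ eq) (reads-prefix u (∷-injectiveʳ eq))

  reads-suffix : ∀ {f} p {v} → Reads f (p ++ v) → Reads (f ∘ (length p +_)) v
  reads-suffix []      rv = rv
  reads-suffix (_ ∷ p) eq = reads-suffix p (∷-injectiveʳ eq)

  reads-factor : ∀ {f} p {u s} → Reads f (p ++ u ++ s) → Reads (f ∘ (length p +_)) u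
  reads-factor p {u} rv = reads-prefix u (reads-suffix p rv)

  reads-five-fourths-power : ∀ {f} x y → length y ≡ 3 * length x → Reads f (x ++ y ++ x) →
    FiveFourthsPowerAt f (length x)
  reads-five-fourths-power {f} x y |y|≡3|x| rv =
    subst (λ k → applyUpTo f (length x) ≡ applyUpTo (f ∘ (length x +_) ∘ (k +_)) (length x))
      |y|≡3|x| (trans (sym (reads-prefix x rv)) (reads-suffix y (reads-suffix x rv)))

digit : ℤ → ℕ
digit (ℤ.+ 0) = 0
digit (ℤ.+ 1) = 1
digit _       = 2

digit-other : ∀ v → v ≢ ℤ.+ 0 → v ≢ ℤ.+ 1 → digit v ≡ 2
digit-other (ℤ.+ 0)               v≢0 _   = contradiction refl v≢0
digit-other (ℤ.+ 1)               _   v≢1 = contradiction refl v≢1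
digit-other (ℤ.+ ℕ.suc (ℕ.suc _)) _   _   = refl
digit-other -[1+ _ ]              _   _   = refl

∈Γ : ∀ a {_ : True (a ∈? Γ)} → a ∈ Γ
∈Γ a {a∈Γ} = toWitness {a? = a ∈? Γ} a∈Γ

shifted-digit : ∀ {n j} c → (ℤ.+ 0 ℤ.- c , j) ∈ Γ → (ℤ.+ 1 ℤ.- c , j) ∈ Γ →
  (n , j) ∉ Γ → digit (n ℤ.+ c) ≡ 2
shifted-digit {n} {j} c 0-c∈Γ 1-c∈Γ n∉Γ = digit-other (n ℤ.+ c) (avoids 0-c∈Γ) (avoids 1-c∈Γ)
  where
  avoids : ∀ {z} → (z ℤ.- c , j) ∈ Γ → n ℤ.+ c ≢ z
  avoids z-c∈Γ n+c≡z = n∉Γ (subst (λ k → (k , j) ∈ Γ) (sym (x≈z//y n c _ n+c≡z)) z-c∈Γ)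

Shape : Set
Shape = ℕ × Fin 8

shape : Letter → Shape
shape (n , j) = digit n , j

_≟ˢ_ : DecidableEquality Shape
_≟ˢ_ = ≡-dec ℕ._≟_ Fin._≟_

-- The shapes of φ(n₀) φ(n₁) φ(n₂) φ(n₃) for letters n_j outside Γ; φ(n_{j+4}) has the
-- same shape as φ(n_j).
cycle : List Shape
cycle = (0 , s0) ∷ (1 , s1) ∷ (0 , s2) ∷ (0 , s3) ∷ (1 , s4) ∷ (2 , s5)
      ∷ (1 , s6) ∷ (1 , s7) ∷ (0 , s0) ∷ (0 , s1) ∷ (0 , s2) ∷ (2 , s3)
      ∷ (1 , s4) ∷ (1 , s5) ∷ (1 , s6) ∷ (0 , s7) ∷ (0 , s0) ∷ (2 , s1)
      ∷ (0 , s2) ∷ (1 , s3) ∷ (1 , s4) ∷ (0 , s5) ∷ (1 , s6) ∷ (2 , s7) ∷ []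

periodic : ℕ → Shape
periodic i = lookup cycle (i mod 24)

periodic-% : ∀ q → periodic ∘ (q +_) ≗ periodic ∘ (q % 24 +_)
periodic-% q i = cong (lookup cycle) (Fin.fromℕ<-cong _ _ [q+i]%24≡[q%24+i]%24 _ _)
  where
  open ≡-Reasoning
  [q+i]%24≡[q%24+i]%24 : (q + i) % 24 ≡ (q % 24 + i) % 24
  [q+i]%24≡[q%24+i]%24 = begin
    (q + i) % 24                 ≡⟨ %-distribˡ-+ q i 24 ⟩
    (q % 24 + i % 24) % 24       ≡⟨ cong (λ t → (t + i % 24) % 24) (m%n%n≡m%n q 24) ⟨
    (q % 24 % 24 + i % 24) % 24  ≡⟨ %-distribˡ-+ (q % 24) i 24 ⟨
    (q % 24 + i) % 24            ∎

no-short-five-fourths-power-in-period :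
  ∀ {r} → r < 24 → ∀ {m} → m < 5 → ¬ FiveFourthsPowerAt (periodic ∘ (r +_)) (ℕ.suc m)
no-short-five-fourths-power-in-period = from-yes
  (allUpTo? {P = λ r → ∀ {m} → m < 5 → ¬ FiveFourthsPowerAt (periodic ∘ (r +_)) (ℕ.suc m)}
    (λ r → allUpTo? (λ m → ¬? (List.≡-dec _≟ˢ_ _ _)) 5) 24)

no-short-five-fourths-power : ∀ q {m} → 1 ≤ m → m ≤ 5 → ¬ FiveFourthsPowerAt (periodic ∘ (q +_)) m
no-short-five-fourths-power q {ℕ.suc m} _ m<5 power =
  no-short-five-fourths-power-in-period (m%n<n q 24) m<5 (five-fourths-power-cong (periodic-% q) power)

open Coding shape

shape-φ : ∀ {n j} → (n , j) ∉ Γ → map shape (φ (n , j)) ≡ applyUpTo (periodic ∘ (6 * toℕ j +_)) 6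
shape-φ {j = zero} a∉Γ =
  cong (λ d → _ ∷ _ ∷ _ ∷ _ ∷ _ ∷ (d , _) ∷ []) (shifted-digit z3 (∈Γ (m3 , s0)) (∈Γ (m2 , s0)) a∉Γ)
shape-φ {j = suc zero} a∉Γ =
  cong (λ d → _ ∷ _ ∷ _ ∷ _ ∷ _ ∷ (d , _) ∷ []) (shifted-digit z2 (∈Γ (m2 , s1)) (∈Γ (m1 , s1)) a∉Γ)
shape-φ {j = suc (suc zero)} a∉Γ =
  cong (λ d → _ ∷ _ ∷ _ ∷ _ ∷ _ ∷ (d , _) ∷ []) (shifted-digit z3 (∈Γ (m3 , s2)) (∈Γ (m2 , s2)) a∉Γ)
shape-φ {j = suc (suc (suc zero))} a∉Γ =
  cong (λ d → _ ∷ _ ∷ _ ∷ _ ∷ _ ∷ (d , _) ∷ []) (shifted-digit z2 (∈Γ (m2 , s3)) (∈Γ (m1 , s3)) a∉Γ)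
shape-φ {j = suc (suc (suc (suc zero)))} a∉Γ =
  cong (λ d → _ ∷ _ ∷ _ ∷ _ ∷ _ ∷ (d , _) ∷ []) (shifted-digit z1 (∈Γ (m1 , s4)) (∈Γ (z0 , s4)) a∉Γ)
shape-φ {j = suc (suc (suc (suc (suc zero))))} a∉Γ =
  cong (λ d → _ ∷ _ ∷ _ ∷ _ ∷ _ ∷ (d , _) ∷ []) (shifted-digit z2 (∈Γ (m2 , s5)) (∈Γ (m1 , s5)) a∉Γ)
shape-φ {j = suc (suc (suc (suc (suc (suc zero)))))} a∉Γ =
  cong (λ d → _ ∷ _ ∷ _ ∷ _ ∷ _ ∷ (d , _) ∷ []) (shifted-digit z1 (∈Γ (m1 , s6)) (∈Γ (z0 , s6)) a∉Γ)
shape-φ {j = suc (suc (suc (suc (suc (suc (suc zero))))))} a∉Γ =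
  cong (λ d → _ ∷ _ ∷ _ ∷ _ ∷ _ ∷ (d , _) ∷ []) (shifted-digit z2 (∈Γ (m2 , s7)) (∈Γ (m1 , s7)) a∉Γ)

reads-next-block : ∀ j {v} → Reads (periodic ∘ (6 * toℕ (suc8 j) +_)) v →
  Reads (periodic ∘ (6 * toℕ j +_) ∘ (6 +_)) v
reads-next-block zero                                           rv = rv
reads-next-block (suc zero)                                     rv = rv
reads-next-block (suc (suc zero))                               rv = rv
reads-next-block (suc (suc (suc zero)))                         rv = rv
reads-next-block (suc (suc (suc (suc zero))))                   rv = rv
reads-next-block (suc (suc (suc (suc (suc zero)))))             rv = rv
reads-next-block (suc (suc (suc (suc (suc (suc zero))))))       rv = rv
reads-next-block (suc (suc (suc (suc (suc (suc (suc zero))))))) rv =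
  reads-cong (sym ∘ periodic-% 48) rv

phase : List Letter → ℕ
phase []      = 0
phase (a ∷ _) = 6 * toℕ (proj₂ a)

reads-φ* : ∀ {w} → SubscriptIncreasing w → AvoidsΓ w → Reads (periodic ∘ (phase w +_)) (φ* w)
reads-φ* []                         []         = refl
reads-φ* [ _ ]                      (a∉Γ ∷ []) = reads-++ _ (shape-φ a∉Γ) refl
reads-φ* (step {a = _ , j} refl si) (a∉Γ ∷ av) =
  reads-++ _ (shape-φ a∉Γ) (reads-next-block j (reads-φ* si av))

lemma4p6 : (w : List Letter) → SubscriptIncreasing w → AvoidsΓ w →
    (u : List Letter) → Factor u (φ* w) → length u ≤ 25 → ¬ FiveFourthsPower u
lemma4p6 w si av _ (p , s , φ*w≡pus) |u|≤25 (x , y , 1≤|x| , |y|≡3|x| , refl) =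
  no-short-five-fourths-power q 1≤|x| |x|≤5 (reads-five-fourths-power x y |y|≡3|x| reads-xyx)
  where
  q = phase w + length p
  reads-xyx : Reads (periodic ∘ (q +_)) (x ++ y ++ x)
  reads-xyx = reads-cong (cong periodic ∘ sym ∘ +-assoc (phase w) (length p))
    (reads-factor p (subst (Reads _) φ*w≡pus (reads-φ* si av)))
  |x|≤5 : length x ≤ 5
  |x|≤5 = *-cancelˡ-≤ 5 (subst (_≤ 25) (length-xyx x y |y|≡3|x|) |u|≤25)
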